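{- If $f\in Q_2\Lambda^*$ is non-zero, then $f\notin\mathcal{H}$.
   Context: Let $\mathcal{R}=\mathbb{Q}[Q_1,Q_2,Q_3,\ldots]$ and $\Lambda^*=\mathbb{Q}[Q_2,Q_3,\ldots]\subset\mathcal R$ be polynomial algebras (in the paper the $Q_i$ are specific algebraically independent functions on eventually constant non-increasing integer sequences, with $Q_2(\lambda)=|\lambda|-\tfrac1{24}$ on partitions; $\Lambda^*$ is the algebra of shifted symmetric polynomials), graded by giving $Q_i$ weight $i$. With $Q_0:=1$, define $\boldsymbol{\partial}=\sum_{m\ge0}Q_m\frac{\partial}{\partial Q_{m+1}}$, $\mathscr{D}=\sum_{k,\ell\ge0}\binom{k+\ell}{k}Q_{k+\ell}\frac{\partial^2}{\partial Q_{k+1}\partial Q_{\ell+1}}$, $\Delta=\tfrac12(\mathscr{D}-\boldsymbol{\partial}^2)$, and $\mathcal{H}=\{f\in\Lambda^*:\Delta f\in Q_1\mathcal{R}\}$. -}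

module Defs where

open import Data.Nat as ℕ using (ℕ; zero; suc; _⊔_)
open import Data.Nat.Combinatorics using (_C_)
open import Data.Rational using (ℚ; 0ℚ; 1ℚ; ½; -_; _+_; _*_; _/_)
open import Data.Integer using (+_)
open import Data.List using (List; []; _∷_; _++_; concatMap; replicate; length; foldr)
open import Data.List.Properties using (≡-dec)
open import Data.Product using (_×_; _,_; ∃)
open import Relation.Nullary using (¬_; yes; no)
open import Relation.Binary.PropositionalEquality using (_≡_; _≢_)

-- Polynomials in Q₁, Q₂, Q₃, … over ℚ.
-- A monomial is a list of exponents: position k holds the exponent of Q_{k+1}
-- (trailing zeros are irrelevant).
Mono : Set
Mono = List ℕ

expo : Mono → ℕ → ℕ
expo []       _       = 0
expo (e ∷ _)  zero    = e
expo (_ ∷ es) (suc k) = expo es k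

trim : Mono → Mono
trim [] = []
trim (e ∷ es) with trim es
... | [] with e
...    | zero  = []
...    | suc n = suc n ∷ []
trim (e ∷ es) | r ∷ rs = e ∷ r ∷ rs

-- A polynomial is a finite formal sum of terms (coefficient, monomial).
Poly : Set
Poly = List (ℚ × Mono)

coeff : Poly → Mono → ℚ
coeff [] m = 0ℚ
coeff ((c , n) ∷ p) m with ≡-dec ℕ._≟_ (trim n) (trim m)
... | yes _ = c + coeff p m
... | no  _ = coeff p m

_≈_ : Poly → Poly → Set
p ≈ q = ∀ m → coeff p m ≡ coeff q m

IsZero : Poly → Set
IsZero p = ∀ m → coeff p m ≡ 0ℚ

scale : ℚ → Poly → Poly
scale a [] = []
scale a ((c , m) ∷ p) = (a * c , m) ∷ scale a p

_+P_ : Poly → Poly → Poly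
p +P q = p ++ q

_-P_ : Poly → Poly → Poly
p -P q = p ++ scale (- 1ℚ) q

mulMono : Mono → Mono → Mono
mulMono [] n = n
mulMono (e ∷ es) [] = e ∷ es
mulMono (e ∷ es) (f ∷ fs) = (e ℕ.+ f) ∷ mulMono es fs

_*P_ : Poly → Poly → Poly
p *P q = concatMap (λ { (c , m) → concatMap (λ { (d , n) → (c * d , mulMono m n) ∷ [] }) q }) p

-- the generator Q_n as a polynomial, with the convention Q₀ = 1
Q : ℕ → Poly
Q zero    = (1ℚ , []) ∷ []
Q (suc k) = (1ℚ , replicate k 0 ++ (1 ∷ [])) ∷ []

decAt : ℕ → Mono → Mono
decAt _       []       = []
decAt zero    (e ∷ es) = ℕ.pred e ∷ es
decAt (suc k) (e ∷ es) = e ∷ decAt k es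

-- ∂/∂Q_{k+1}
deriv : ℕ → Poly → Poly
deriv k = concatMap (λ { (c , m) → (c * (+ expo m k / 1) , decAt k m) ∷ [] })

-- number of variable positions occurring in p (all ∂/∂Q_j with j > bound vanish)
bound : Poly → ℕ
bound = foldr (λ { (_ , m) b → length m ⊔ b }) 0

sumBelow : ℕ → (ℕ → Poly) → Poly
sumBelow zero    f = []
sumBelow (suc n) f = sumBelow n f +P f n

-- bold ∂ = Σ_{m ≥ 0} Q_m ∂/∂Q_{m+1}
bd : Poly → Poly
bd p = sumBelow (bound p) (λ m → Q m *P deriv m p)

-- 𝒟 = Σ_{k,ℓ ≥ 0} binom(k+ℓ,k) Q_{k+ℓ} ∂²/∂Q_{k+1}∂Q_{ℓ+1}
𝒟 : Poly → Poly
𝒟 p = sumBelow (bound p) (λ k → sumBelow (bound p) (λ ℓ →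
        scale (+ ((k ℕ.+ ℓ) C k) / 1) (Q (k ℕ.+ ℓ) *P deriv k (deriv ℓ p))))

Δ : Poly → Poly
Δ p = scale ½ (𝒟 p -P bd (bd p))

-- membership in Λ* = ℚ[Q₂,Q₃,…]: no monomial involving Q₁ occurs
InΛ : Poly → Set
InΛ p = ∀ m → expo m 0 ≢ 0 → coeff p m ≡ 0ℚ

InQ₁ℛ : Poly → Set
InQ₁ℛ p = ∃ λ g → p ≈ (Q 1 *P g)

InQ₂Λ : Poly → Set
InQ₂Λ p = ∃ λ g → InΛ g × p ≈ (Q 2 *P g)

Inℋ : Poly → Set
Inℋ f = InΛ f × InQ₁ℛ (Δ f)

{-# OPTIONS --safe #-}
-- Suppose f ≠ 0 and let m be a monomial of f of least degree and, among those, of least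
-- exponent a + 1 of Q₂; it is free of Q₁ as f ∈ Λ*, and a + 1 ≥ 1 as Q₂ ∣ f. Since Δf ∈ Q₁ℛ,
-- the Q₁-free monomial x = m / Q₂ has the same coefficient in 𝒟f and in ∂²f. By minimality the
-- only contributions come from terms that reproduce m: in ∂²f this is Q₀∂/∂Q₁ ∘ Q₁∂/∂Q₂, giving
-- (a + 1) f_m, while 𝒟f gives w (a + 1) f_m, where w collects the terms of 𝒟 with k = 1 or ℓ = 1,
-- each contributing 0 or a binomial coefficient ≥ 2 times an exponent; so w ≠ 1, a contradiction.
module Submission where

open import Defs
open import Data.Nat as ℕ using (ℕ; zero; suc; _≤_; _<_; z≤n; s≤s)
import Data.Nat.Properties as ℕP
open import Data.Nat.Combinatorics using (_C_; nC1≡n; nCk≡nC[n∸k])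
open import Data.Nat.Induction using (<-rec)
import Data.Integer as ℤ
import Data.Integer.Properties as ℤP
import Data.Integer.Solver as ℤSolver
open import Data.List using ([]; _∷_; _++_; replicate; length)
open import Data.List.Properties using (≡-dec)
open import Data.Rational using (ℚ; 0ℚ; 1ℚ; ½; -_; _+_; _*_; _/_; 1/_; mkℚ; toℚᵘ; ↥_; ≢-nonZero)
import Data.Rational.Properties as ℚP
import Data.Rational.Solver as ℚSolver
import Data.Rational.Unnormalised as ℚᵘ
import Data.Rational.Unnormalised.Properties as ℚᵘP
import Data.Nat.Coprimality as Coprimality
open import Data.Product using (_,_)
open import Data.Sum using (_⊎_; inj₁; inj₂)
open import Data.Empty using (⊥; ⊥-elim)
open import Relation.Nullary using (¬_; yes; no; Dec)
open import Relation.Binary.PropositionalEquality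

infix 4 _≋_

record _≋_ (n m : Mono) : Set where
  constructor mk≋
  field expo-≋ : ∀ j → expo n j ≡ expo m j
open _≋_

≋-sym : ∀ {a b} → a ≋ b → b ≋ a
≋-sym h = mk≋ λ j → sym (expo-≋ h j)

≋-trans : ∀ {a b c} → a ≋ b → b ≋ c → a ≋ c
≋-trans h g = mk≋ λ j → trans (expo-≋ h j) (expo-≋ g j)

trimCons : ℕ → Mono → Mono
trimCons e       (r ∷ rs) = e ∷ r ∷ rs
trimCons zero    []       = []
trimCons (suc n) []       = suc n ∷ []

trim-∷ : ∀ e es → trim (e ∷ es) ≡ trimCons e (trim es)
trim-∷ e es with trim es
... | [] with e
...    | zero  = refl
...    | suc n = refl
trim-∷ e es | r ∷ rs = refl

expo-trimCons : ∀ e r j → expo (trimCons e r) j ≡ expo (e ∷ r) j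
expo-trimCons zero    []       zero    = refl
expo-trimCons zero    []       (suc j) = refl
expo-trimCons (suc n) []       j       = refl
expo-trimCons e       (r ∷ rs) j       = refl

expo-trim : ∀ n j → expo (trim n) j ≡ expo n j
expo-trim []       j       = refl
expo-trim (e ∷ es) j rewrite trim-∷ e es = trans (expo-trimCons e (trim es) j) (expo-∷ j)
  where
  expo-∷ : ∀ j → expo (e ∷ trim es) j ≡ expo (e ∷ es) j
  expo-∷ zero    = refl
  expo-∷ (suc j) = expo-trim es j

trim≡⇒≋ : ∀ {n m} → trim n ≡ trim m → n ≋ m
trim≡⇒≋ {n} {m} eq = mk≋ λ j → trans (sym (expo-trim n j)) (trans (cong (λ t → expo t j) eq) (expo-trim m j))

trim-constant : ∀ m → (∀ j → expo m j ≡ 0) → trim m ≡ []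
trim-constant []       h = refl
trim-constant (f ∷ fs) h rewrite trim-∷ f fs | trim-constant fs (λ j → h (suc j)) | h 0 = refl

≋⇒trim≡ : ∀ {n m} → n ≋ m → trim n ≡ trim m
≋⇒trim≡ {[]}     {[]}     h = refl
≋⇒trim≡ {[]}     {f ∷ fs} h = sym (trim-constant (f ∷ fs) (λ j → sym (expo-≋ h j)))
≋⇒trim≡ {e ∷ es} {[]}     h = trim-constant (e ∷ es) (expo-≋ h)
≋⇒trim≡ {e ∷ es} {f ∷ fs} h
  rewrite trim-∷ e es | trim-∷ f fs | expo-≋ h 0 | ≋⇒trim≡ {es} {fs} (mk≋ λ j → expo-≋ h (suc j)) = refl

_≋?_ : ∀ n m → Dec (n ≋ m)
n ≋? m with ≡-dec ℕ._≟_ (trim n) (trim m)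
... | yes p = yes (trim≡⇒≋ p)
... | no ¬p = no (λ h → ¬p (≋⇒trim≡ h))

inc : ℕ → Mono → Mono
inc zero    []       = 1 ∷ []
inc zero    (e ∷ es) = suc e ∷ es
inc (suc k) []       = 0 ∷ inc k []
inc (suc k) (e ∷ es) = e ∷ inc k es

expo-inc : ∀ k m → expo (inc k m) k ≡ suc (expo m k)
expo-inc zero    []      = refl
expo-inc zero    (e ∷ m) = refl
expo-inc (suc k) []      = expo-inc k []
expo-inc (suc k) (e ∷ m) = expo-inc k m

expo-inc-≢ : ∀ k m j → j ≢ k → expo (inc k m) j ≡ expo m j
expo-inc-≢ zero    []      zero    ne = ⊥-elim (ne refl)
expo-inc-≢ zero    []      (suc j) ne = refl
expo-inc-≢ zero    (e ∷ m) zero    ne = ⊥-elim (ne refl)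
expo-inc-≢ zero    (e ∷ m) (suc j) ne = refl
expo-inc-≢ (suc k) []      zero    ne = refl
expo-inc-≢ (suc k) []      (suc j) ne = expo-inc-≢ k [] j (λ q → ne (cong suc q))
expo-inc-≢ (suc k) (e ∷ m) zero    ne = refl
expo-inc-≢ (suc k) (e ∷ m) (suc j) ne = expo-inc-≢ k m j (λ q → ne (cong suc q))

expo-decAt : ∀ k m → expo (decAt k m) k ≡ ℕ.pred (expo m k)
expo-decAt zero    []      = refl
expo-decAt zero    (e ∷ m) = refl
expo-decAt (suc k) []      = refl
expo-decAt (suc k) (e ∷ m) = expo-decAt k m

expo-decAt-≢ : ∀ k m j → j ≢ k → expo (decAt k m) j ≡ expo m j
expo-decAt-≢ k       []      j       ne = refl
expo-decAt-≢ zero    (e ∷ m) zero    ne = ⊥-elim (ne refl)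
expo-decAt-≢ zero    (e ∷ m) (suc j) ne = refl
expo-decAt-≢ (suc k) (e ∷ m) zero    ne = refl
expo-decAt-≢ (suc k) (e ∷ m) (suc j) ne = expo-decAt-≢ k m j (λ q → ne (cong suc q))

expo-mulMono : ∀ a b j → expo (mulMono a b) j ≡ expo a j ℕ.+ expo b j
expo-mulMono []      b       j       = refl
expo-mulMono (e ∷ a) []      j       = sym (ℕP.+-identityʳ _)
expo-mulMono (e ∷ a) (f ∷ b) zero    = refl
expo-mulMono (e ∷ a) (f ∷ b) (suc j) = expo-mulMono a b j

var : ℕ → Mono
var i = replicate i 0 ++ (1 ∷ [])

expo-var : ∀ i → expo (var i) i ≡ 1
expo-var zero    = refl
expo-var (suc i) = expo-var i

expo-var-≢ : ∀ i j → j ≢ i → expo (var i) j ≡ 0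
expo-var-≢ zero    zero    ne = ⊥-elim (ne refl)
expo-var-≢ zero    (suc j) ne = refl
expo-var-≢ (suc i) zero    ne = refl
expo-var-≢ (suc i) (suc j) ne = expo-var-≢ i j (λ q → ne (cong suc q))

inc-cong : ∀ k {n m} → n ≋ m → inc k n ≋ inc k m
inc-cong k {n} {m} h = mk≋ pointwise
  where
  pointwise : ∀ j → expo (inc k n) j ≡ expo (inc k m) j
  pointwise j with j ℕ.≟ k
  ... | yes refl = trans (expo-inc k n) (trans (cong suc (expo-≋ h k)) (sym (expo-inc k m)))
  ... | no ne    = trans (expo-inc-≢ k n j ne) (trans (expo-≋ h j) (sym (expo-inc-≢ k m j ne)))

decAt-cong : ∀ k {n m} → n ≋ m → decAt k n ≋ decAt k m
decAt-cong k {n} {m} h = mk≋ pointwise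
  where
  pointwise : ∀ j → expo (decAt k n) j ≡ expo (decAt k m) j
  pointwise j with j ℕ.≟ k
  ... | yes refl = trans (expo-decAt k n) (trans (cong ℕ.pred (expo-≋ h k)) (sym (expo-decAt k m)))
  ... | no ne    = trans (expo-decAt-≢ k n j ne) (trans (expo-≋ h j) (sym (expo-decAt-≢ k m j ne)))

inc-decAt : ∀ k y {t} → expo y k ≡ suc t → inc k (decAt k y) ≋ y
inc-decAt k y e = mk≋ pointwise
  where
  pointwise : ∀ j → expo (inc k (decAt k y)) j ≡ expo y j
  pointwise j with j ℕ.≟ k
  ... | yes refl = trans (expo-inc j (decAt j y))
                     (trans (cong suc (expo-decAt j y)) (trans (cong (λ u → suc (ℕ.pred u)) e) (sym e)))
  ... | no ne    = trans (expo-inc-≢ k (decAt k y) j ne) (expo-decAt-≢ k y j ne)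

decAt-inc : ∀ k y → decAt k (inc k y) ≋ y
decAt-inc k y = mk≋ pointwise
  where
  pointwise : ∀ j → expo (decAt k (inc k y)) j ≡ expo y j
  pointwise j with j ℕ.≟ k
  ... | yes refl = trans (expo-decAt j (inc j y)) (cong ℕ.pred (expo-inc j y))
  ... | no ne    = trans (expo-decAt-≢ k (inc k y) j ne) (expo-inc-≢ k y j ne)

inc-comm : ∀ a b y → inc a (inc b y) ≋ inc b (inc a y)
inc-comm a b y = mk≋ pointwise
  where
  pointwise : ∀ j → expo (inc a (inc b y)) j ≡ expo (inc b (inc a y)) j
  pointwise j with j ℕ.≟ a | j ℕ.≟ b
  ... | yes refl | yes refl = refl
  ... | yes refl | no nb    = trans (expo-inc j (inc b y)) (trans (cong suc (expo-inc-≢ b y j nb))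
                                (trans (sym (expo-inc j y)) (sym (expo-inc-≢ b (inc j y) j nb))))
  ... | no na    | yes refl = trans (expo-inc-≢ a (inc j y) j na) (trans (expo-inc j y)
                                (trans (cong suc (sym (expo-inc-≢ a y j na))) (sym (expo-inc j (inc a y)))))
  ... | no na    | no nb    = trans (expo-inc-≢ a (inc b y) j na) (trans (expo-inc-≢ b y j nb)
                                (trans (sym (expo-inc-≢ a y j na)) (sym (expo-inc-≢ b (inc a y) j nb))))

deg : Mono → ℕ
deg []      = 0
deg (e ∷ m) = e ℕ.+ deg m

deg-inc : ∀ k m → deg (inc k m) ≡ suc (deg m)
deg-inc zero    []      = refl
deg-inc zero    (e ∷ m) = refl
deg-inc (suc k) []      = deg-inc k []
deg-inc (suc k) (e ∷ m) = trans (cong (e ℕ.+_) (deg-inc k m)) (ℕP.+-suc e (deg m))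

deg-decAt : ∀ k m {t} → expo m k ≡ suc t → suc (deg (decAt k m)) ≡ deg m
deg-decAt zero    (e ∷ m) refl = refl
deg-decAt (suc k) (e ∷ m) eq   = trans (sym (ℕP.+-suc e (deg (decAt k m)))) (cong (e ℕ.+_) (deg-decAt k m eq))

expo-beyond-length : ∀ n k → length n ≤ k → expo n k ≡ 0
expo-beyond-length []      k       le        = refl
expo-beyond-length (e ∷ n) (suc k) (s≤s le) = expo-beyond-length n k le

fromℕ : ℕ → ℚ
fromℕ n = ℤ.+ n / 1

fromℕ≡mkℚ : ∀ n → fromℕ n ≡ mkℚ (ℤ.+ n) 0 (Coprimality.sym (Coprimality.1-coprimeTo n))
fromℕ≡mkℚ n = ℚP.normalize-coprime (Coprimality.sym (Coprimality.1-coprimeTo n))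

toℚᵘ-fromℕ : ∀ n → toℚᵘ (fromℕ n) ≡ ℚᵘ.mkℚᵘ (ℤ.+ n) 0
toℚᵘ-fromℕ n = cong toℚᵘ (fromℕ≡mkℚ n)

module _ where
  open ℤSolver.+-*-Solver

  fromℕ-+ : ∀ a b → fromℕ (a ℕ.+ b) ≡ fromℕ a + fromℕ b
  fromℕ-+ a b = ℚP.toℚᵘ-injective (ℚᵘP.≃-trans (ℚᵘP.≃-reflexive (toℚᵘ-fromℕ (a ℕ.+ b)))
    (ℚᵘP.≃-trans (ℚᵘ.*≡* integral)
      (ℚᵘP.≃-sym (ℚᵘP.≃-trans (ℚP.toℚᵘ-homo-+ (fromℕ a) (fromℕ b))
        (ℚᵘP.≃-reflexive (cong₂ ℚᵘ._+_ (toℚᵘ-fromℕ a) (toℚᵘ-fromℕ b)))))))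
    where
    integral : ℤ.+ (a ℕ.+ b) ℤ.* ℤ.+ 1 ≡ (ℤ.+ a ℤ.* ℤ.+ 1 ℤ.+ ℤ.+ b ℤ.* ℤ.+ 1) ℤ.* ℤ.+ 1
    integral = trans (cong (ℤ._* ℤ.+ 1) (ℤP.pos-+ a b))
      (solve 2 (λ x y → (x :+ y) :* con (ℤ.+ 1) := (x :* con (ℤ.+ 1) :+ y :* con (ℤ.+ 1)) :* con (ℤ.+ 1))
         refl (ℤ.+ a) (ℤ.+ b))

  fromℕ-* : ∀ a b → fromℕ (a ℕ.* b) ≡ fromℕ a * fromℕ b
  fromℕ-* a b = ℚP.toℚᵘ-injective (ℚᵘP.≃-trans (ℚᵘP.≃-reflexive (toℚᵘ-fromℕ (a ℕ.* b)))
    (ℚᵘP.≃-trans (ℚᵘ.*≡* integral)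
      (ℚᵘP.≃-sym (ℚᵘP.≃-trans (ℚP.toℚᵘ-homo-* (fromℕ a) (fromℕ b))
        (ℚᵘP.≃-reflexive (cong₂ ℚᵘ._*_ (toℚᵘ-fromℕ a) (toℚᵘ-fromℕ b)))))))
    where
    integral : ℤ.+ (a ℕ.* b) ℤ.* ℤ.+ 1 ≡ (ℤ.+ a ℤ.* ℤ.+ b) ℤ.* ℤ.+ 1
    integral = cong (ℤ._* ℤ.+ 1) (ℤP.pos-* a b)

fromℕ-injective : ∀ {a b} → fromℕ a ≡ fromℕ b → a ≡ b
fromℕ-injective {a} {b} eq = ℤP.+-injective (cong ↥_ (trans (sym (fromℕ≡mkℚ a)) (trans eq (fromℕ≡mkℚ b))))

*-cancelˡ-≡ : ∀ r {p q} → r ≢ 0ℚ → r * p ≡ r * q → p ≡ q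
*-cancelˡ-≡ r {p} {q} r≢0 eq = begin
    p                ≡⟨ sym (ℚP.*-identityˡ p) ⟩
    1ℚ * p           ≡⟨ cong (_* p) (sym (ℚP.*-inverseˡ r)) ⟩
    (1/ r) * r * p   ≡⟨ ℚP.*-assoc (1/ r) r p ⟩
    (1/ r) * (r * p) ≡⟨ cong ((1/ r) *_) eq ⟩
    (1/ r) * (r * q) ≡⟨ sym (ℚP.*-assoc (1/ r) r q) ⟩
    (1/ r) * r * q   ≡⟨ cong (_* q) (ℚP.*-inverseˡ r) ⟩
    1ℚ * q           ≡⟨ ℚP.*-identityˡ q ⟩
    q                ∎
  where
  open ≡-Reasoning
  instance _ = ≢-nonZero r≢0

½[p-q]≡0⇒p≡q : ∀ p q → ½ * (p + (- 1ℚ) * q) ≡ 0ℚ → p ≡ q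
½[p-q]≡0⇒p≡q p q eq = begin
    p                          ≡⟨ solve 2 (λ p q → p := (p :+ con (- 1ℚ) :* q) :+ q) refl p q ⟩
    (p + (- 1ℚ) * q) + q       ≡⟨ cong (_+ q) p-q≡0 ⟩
    0ℚ + q                     ≡⟨ ℚP.+-identityˡ q ⟩
    q                          ∎
  where
  open ≡-Reasoning
  open ℚSolver.+-*-Solver
  p-q≡0 : p + (- 1ℚ) * q ≡ 0ℚ
  p-q≡0 = *-cancelˡ-≡ ½ (λ ()) (trans eq (sym (ℚP.*-zeroʳ ½)))

coeff-∷-≋ : ∀ {c n m} p → n ≋ m → coeff ((c , n) ∷ p) m ≡ c + coeff p m
coeff-∷-≋ {c} {n} {m} p h with ≡-dec ℕ._≟_ (trim n) (trim m)
... | yes _ = refl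
... | no ¬q = ⊥-elim (¬q (≋⇒trim≡ h))

coeff-∷-≉ : ∀ {c n m} p → ¬ (n ≋ m) → coeff ((c , n) ∷ p) m ≡ coeff p m
coeff-∷-≉ {c} {n} {m} p h with ≡-dec ℕ._≟_ (trim n) (trim m)
... | yes q = ⊥-elim (h (trim≡⇒≋ q))
... | no _  = refl

coeff-∷-0ℚ : ∀ {c n m} p → c ≡ 0ℚ → coeff ((c , n) ∷ p) m ≡ coeff p m
coeff-∷-0ℚ {c} {n} {m} p refl with n ≋? m
... | yes h = trans (coeff-∷-≋ p h) (ℚP.+-identityˡ _)
... | no h  = coeff-∷-≉ p h

coeff-cong : ∀ p {m m'} → m ≋ m' → coeff p m ≡ coeff p m'
coeff-cong []            h = refl
coeff-cong ((c , n) ∷ p) {m} {m'} h with n ≋? m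
... | yes q = trans (coeff-∷-≋ p q)
               (trans (cong (c +_) (coeff-cong p h)) (sym (coeff-∷-≋ p (≋-trans q h))))
... | no q  = trans (coeff-∷-≉ p q)
               (trans (coeff-cong p h) (sym (coeff-∷-≉ p (λ r → q (≋-trans r (≋-sym h))))))

coeff-++ : ∀ p q m → coeff (p ++ q) m ≡ coeff p m + coeff q m
coeff-++ []            q m = sym (ℚP.+-identityˡ _)
coeff-++ ((c , n) ∷ p) q m with n ≋? m
... | yes h = trans (coeff-∷-≋ (p ++ q) h) (trans (cong (c +_) (coeff-++ p q m))
                (trans (sym (ℚP.+-assoc c _ _)) (cong (_+ coeff q m) (sym (coeff-∷-≋ p h)))))
... | no h  = trans (coeff-∷-≉ (p ++ q) h) (trans (coeff-++ p q m)
                (cong (_+ coeff q m) (sym (coeff-∷-≉ p h))))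

coeff-scale : ∀ a p m → coeff (scale a p) m ≡ a * coeff p m
coeff-scale a []            m = sym (ℚP.*-zeroʳ a)
coeff-scale a ((c , n) ∷ p) m with n ≋? m
... | yes h = trans (coeff-∷-≋ (scale a p) h) (trans (cong (a * c +_) (coeff-scale a p m))
                (trans (sym (ℚP.*-distribˡ-+ a c _)) (cong (a *_) (sym (coeff-∷-≋ p h)))))
... | no h  = trans (coeff-∷-≉ (scale a p) h) (trans (coeff-scale a p m)
                (cong (a *_) (sym (coeff-∷-≉ p h))))

coeff-Δ : ∀ p m → coeff (Δ p) m ≡ ½ * (coeff (𝒟 p) m + (- 1ℚ) * coeff (bd (bd p)) m)
coeff-Δ p m = begin
  coeff (Δ p) m                                                     ≡⟨ coeff-scale ½ (𝒟 p -P bd (bd p)) m ⟩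
  ½ * coeff (𝒟 p ++ scale (- 1ℚ) (bd (bd p))) m                     ≡⟨ cong (½ *_) (coeff-++ (𝒟 p) _ m) ⟩
  ½ * (coeff (𝒟 p) m + coeff (scale (- 1ℚ) (bd (bd p))) m)          ≡⟨ cong (λ r → ½ * (coeff (𝒟 p) m + r))
                                                                         (coeff-scale (- 1ℚ) (bd (bd p)) m) ⟩
  ½ * (coeff (𝒟 p) m + (- 1ℚ) * coeff (bd (bd p)) m)                ∎
  where open ≡-Reasoning

coeff-deriv : ∀ k p m → coeff (deriv k p) m ≡ fromℕ (suc (expo m k)) * coeff p (inc k m)
coeff-deriv k []            m = sym (ℚP.*-zeroʳ (fromℕ (suc (expo m k))))
coeff-deriv k ((c , n) ∷ p) m with expo n k in eq
... | zero  = trans (coeff-∷-0ℚ {n = decAt k n} (deriv k p) (ℚP.*-zeroʳ c))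
               (trans (coeff-deriv k p m) (cong (fromℕ (suc (expo m k)) *_) (sym (coeff-∷-≉ p n≉))))
  where
  n≉ : ¬ (n ≋ inc k m)
  n≉ h with trans (sym eq) (trans (expo-≋ h k) (expo-inc k m))
  ... | ()
... | suc e with decAt k n ≋? m
...   | yes h = begin
    coeff ((c * fromℕ (suc e) , decAt k n) ∷ deriv k p) m ≡⟨ coeff-∷-≋ (deriv k p) h ⟩
    c * fromℕ (suc e) + coeff (deriv k p) m               ≡⟨ cong₂ (λ u v → c * fromℕ (suc u) + v) e≡
                                                                  (coeff-deriv k p m) ⟩
    c * N + N * coeff p (inc k m)                         ≡⟨ cong (_+ N * coeff p (inc k m)) (ℚP.*-comm c N) ⟩
    N * c + N * coeff p (inc k m)                         ≡⟨ sym (ℚP.*-distribˡ-+ N c (coeff p (inc k m))) ⟩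
    N * (c + coeff p (inc k m))                           ≡⟨ cong (N *_) (sym (coeff-∷-≋ p n≋)) ⟩
    N * coeff ((c , n) ∷ p) (inc k m)                     ∎
  where
  open ≡-Reasoning
  N = fromℕ (suc (expo m k))
  e≡ : e ≡ expo m k
  e≡ = trans (cong ℕ.pred (sym eq)) (trans (sym (expo-decAt k n)) (expo-≋ h k))
  n≋ : n ≋ inc k m
  n≋ = ≋-trans (≋-sym (inc-decAt k n eq)) (inc-cong k h)
...   | no h  = trans (coeff-∷-≉ (deriv k p) h)
                 (trans (coeff-deriv k p m) (cong (fromℕ (suc (expo m k)) *_) (sym (coeff-∷-≉ p n≉))))
  where
  n≉ : ¬ (n ≋ inc k m)
  n≉ q = h (≋-trans (decAt-cong k q) (decAt-inc k m))

coeff-Q₀* : ∀ p m → coeff (Q zero *P p) m ≡ coeff p m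
coeff-Q₀* []            m = refl
coeff-Q₀* ((d , n) ∷ p) m with n ≋? m
... | yes h = trans (coeff-∷-≋ (Q zero *P p) h)
                (trans (cong₂ _+_ (ℚP.*-identityˡ d) (coeff-Q₀* p m)) (sym (coeff-∷-≋ p h)))
... | no h  = trans (coeff-∷-≉ (Q zero *P p) h)
                (trans (coeff-Q₀* p m) (sym (coeff-∷-≉ p h)))

coeff-Q*-absent : ∀ i p m → expo m i ≡ 0 → coeff (Q (suc i) *P p) m ≡ 0ℚ
coeff-Q*-absent i []            m e = refl
coeff-Q*-absent i ((d , n) ∷ p) m e =
  trans (coeff-∷-≉ (Q (suc i) *P p) ≉m) (coeff-Q*-absent i p m e)
  where
  ≉m : ¬ (mulMono (var i) n ≋ m)
  ≉m h with trans (sym (trans (expo-mulMono (var i) n i) (cong (ℕ._+ expo n i) (expo-var i))))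
                 (trans (expo-≋ h i) e)
  ... | ()

mulMono-var≋inc : ∀ i n → mulMono (var i) n ≋ inc i n
mulMono-var≋inc i n = mk≋ pointwise
  where
  pointwise : ∀ j → expo (mulMono (var i) n) j ≡ expo (inc i n) j
  pointwise j with j ℕ.≟ i
  ... | yes refl = trans (expo-mulMono (var j) n j) (trans (cong (ℕ._+ expo n j) (expo-var j)) (sym (expo-inc j n)))
  ... | no ne    = trans (expo-mulMono (var i) n j)
                     (trans (cong (ℕ._+ expo n j) (expo-var-≢ i j ne)) (sym (expo-inc-≢ i n j ne)))

coeff-Q*-present : ∀ i p m {t} → expo m i ≡ suc t → coeff (Q (suc i) *P p) m ≡ coeff p (decAt i m)
coeff-Q*-present i []            m e = refl
coeff-Q*-present i ((d , n) ∷ p) m e with n ≋? decAt i m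
... | yes h = trans (coeff-∷-≋ (Q (suc i) *P p) var·n≋m)
                (trans (cong₂ _+_ (ℚP.*-identityˡ d) (coeff-Q*-present i p m e)) (sym (coeff-∷-≋ p h)))
  where
  var·n≋m : mulMono (var i) n ≋ m
  var·n≋m = ≋-trans (mulMono-var≋inc i n) (≋-trans (inc-cong i h) (inc-decAt i m e))
... | no h  = trans (coeff-∷-≉ (Q (suc i) *P p) var·n≉m)
                (trans (coeff-Q*-present i p m e) (sym (coeff-∷-≉ p h)))
  where
  var·n≉m : ¬ (mulMono (var i) n ≋ m)
  var·n≉m q = h (≋-trans (≋-sym (decAt-inc i n))
                  (decAt-cong i (≋-trans (≋-sym (mulMono-var≋inc i n)) q)))

coeff-beyond-bound : ∀ p n k {t} → bound p ≤ k → expo n k ≡ suc t → coeff p n ≡ 0ℚ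
coeff-beyond-bound []             n k le e = refl
coeff-beyond-bound ((c , n') ∷ p) n k le e =
  trans (coeff-∷-≉ p n'≉n) (coeff-beyond-bound p n k (ℕP.≤-trans (ℕP.m≤n⊔m (length n') (bound p)) le) e)
  where
  n'≉n : ¬ (n' ≋ n)
  n'≉n h with trans (sym (expo-beyond-length n' k (ℕP.≤-trans (ℕP.m≤m⊔n (length n') (bound p)) le)))
                    (trans (expo-≋ h k) e)
  ... | ()

nonzero-coeff⇒<bound : ∀ p n k {t} → coeff p n ≢ 0ℚ → expo n k ≡ suc t → k < bound p
nonzero-coeff⇒<bound p n k nz e with k ℕ.<? bound p
... | yes lt  = lt
... | no ≮    = ⊥-elim (nz (coeff-beyond-bound p n k (ℕP.≮⇒≥ ≮) e))

∑ : ℕ → (ℕ → ℚ) → ℚ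
∑ zero    g = 0ℚ
∑ (suc n) g = ∑ n g + g n

coeff-sumBelow : ∀ N F m → coeff (sumBelow N F) m ≡ ∑ N (λ i → coeff (F i) m)
coeff-sumBelow zero    F m = refl
coeff-sumBelow (suc N) F m = trans (coeff-++ (sumBelow N F) (F N) m) (cong (_+ coeff (F N) m) (coeff-sumBelow N F m))

∑-cong : ∀ N {g h} → (∀ i → i < N → g i ≡ h i) → ∑ N g ≡ ∑ N h
∑-cong zero    eq = refl
∑-cong (suc N) eq = cong₂ _+_ (∑-cong N (λ i lt → eq i (ℕP.m≤n⇒m≤1+n lt))) (eq N ℕP.≤-refl)

∑-zero : ∀ N {g} → (∀ i → i < N → g i ≡ 0ℚ) → ∑ N g ≡ 0ℚ
∑-zero zero    eq = refl
∑-zero (suc N) eq =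
  trans (cong₂ _+_ (∑-zero N (λ i lt → eq i (ℕP.m≤n⇒m≤1+n lt))) (eq N ℕP.≤-refl)) (ℚP.+-identityˡ 0ℚ)

∑-single : ∀ N {g} i₀ → i₀ < N → (∀ i → i < N → i ≢ i₀ → g i ≡ 0ℚ) → ∑ N g ≡ g i₀
∑-single (suc N) {g} i₀ lt eq with N ℕ.≟ i₀
... | yes refl = trans (cong (_+ g N) (∑-zero N (λ i lt' → eq i (ℕP.m≤n⇒m≤1+n lt') (ℕP.<⇒≢ lt'))))
                   (ℚP.+-identityˡ _)
... | no ne    = trans (cong₂ _+_ (∑-single N i₀ (ℕP.≤∧≢⇒< (ℕP.≤-pred lt) (λ q → ne (sym q)))
                                     (λ i lt' → eq i (ℕP.m≤n⇒m≤1+n lt')))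
                                   (eq N ℕP.≤-refl ne))
                   (ℚP.+-identityʳ _)

∑-extend : ∀ B N {g} → B ≤ N → (∀ i → B ≤ i → g i ≡ 0ℚ) → ∑ B g ≡ ∑ N g
∑-extend B zero    z≤n eq = refl
∑-extend B (suc N) {g} le eq with B ℕ.≟ suc N
... | yes refl = refl
... | no ne    = trans (∑-extend B N B≤N eq)
                   (trans (sym (ℚP.+-identityʳ _)) (cong (∑ N g +_) (sym (eq N B≤N))))
  where
  B≤N : B ≤ N
  B≤N = ℕP.≤-pred (ℕP.≤∧≢⇒< le ne)

∑ℕ : ℕ → (ℕ → ℕ) → ℕ
∑ℕ zero    g = 0
∑ℕ (suc n) g = ∑ℕ n g ℕ.+ g n

∑-*fromℕ : ∀ N c h → ∑ N (λ i → c * fromℕ (h i)) ≡ c * fromℕ (∑ℕ N h)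
∑-*fromℕ zero    c h = sym (ℚP.*-zeroʳ c)
∑-*fromℕ (suc N) c h = begin
  ∑ N (λ i → c * fromℕ (h i)) + c * fromℕ (h N) ≡⟨ cong (_+ c * fromℕ (h N)) (∑-*fromℕ N c h) ⟩
  c * fromℕ (∑ℕ N h) + c * fromℕ (h N)          ≡⟨ sym (ℚP.*-distribˡ-+ c _ _) ⟩
  c * (fromℕ (∑ℕ N h) + fromℕ (h N))            ≡⟨ cong (c *_) (sym (fromℕ-+ (∑ℕ N h) (h N))) ⟩
  c * fromℕ (∑ℕ N h ℕ.+ h N)                    ∎
  where open ≡-Reasoning

∑ℕ-cong : ∀ N {g h} → (∀ i → g i ≡ h i) → ∑ℕ N g ≡ ∑ℕ N h
∑ℕ-cong zero    eq = refl
∑ℕ-cong (suc N) eq = cong₂ ℕ._+_ (∑ℕ-cong N eq) (eq N)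

∑ℕ-*ʳ : ∀ N u a → ∑ℕ N (λ i → u i ℕ.* a) ≡ ∑ℕ N u ℕ.* a
∑ℕ-*ʳ zero    u a = refl
∑ℕ-*ʳ (suc N) u a = trans (cong (ℕ._+ u N ℕ.* a) (∑ℕ-*ʳ N u a)) (sym (ℕP.*-distribʳ-+ a (∑ℕ N u) (u N)))

ZeroOr≥2 : ℕ → Set
ZeroOr≥2 n = n ≡ 0 ⊎ 2 ≤ n

ZeroOr≥2-+ : ∀ {a b} → ZeroOr≥2 a → ZeroOr≥2 b → ZeroOr≥2 (a ℕ.+ b)
ZeroOr≥2-+ (inj₁ refl) zb = zb
ZeroOr≥2-+ {a} {b} (inj₂ le) zb = inj₂ (ℕP.≤-trans le (ℕP.m≤m+n a b))

ZeroOr≥2-* : ∀ {b} → 2 ≤ b → ∀ e → ZeroOr≥2 (b ℕ.* e)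
ZeroOr≥2-* {b} le zero    = inj₁ (ℕP.*-zeroʳ b)
ZeroOr≥2-* {b} le (suc e) = inj₂ (ℕP.≤-trans le (ℕP.m≤m*n b (suc e)))

ZeroOr≥2-∑ℕ : ∀ N u → (∀ i → ZeroOr≥2 (u i)) → ZeroOr≥2 (∑ℕ N u)
ZeroOr≥2-∑ℕ zero    u h = inj₁ refl
ZeroOr≥2-∑ℕ (suc N) u h = ZeroOr≥2-+ (ZeroOr≥2-∑ℕ N u h) (h N)

ZeroOr≥2⇒≢1 : ∀ {n} → ZeroOr≥2 n → n ≢ 1
ZeroOr≥2⇒≢1 (inj₁ refl) ()
ZeroOr≥2⇒≢1 (inj₂ (s≤s ())) refl

-- x / Q_i, with the convention Q₀ = 1
divQ : ℕ → Mono → Mono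
divQ zero    x = x
divQ (suc j) x = decAt j x

data Q[_]∣_ : ℕ → Mono → Set where
  Q₀∣ : ∀ {x} → Q[ zero ]∣ x
  Qₛ∣ : ∀ {j x t} → expo x j ≡ suc t → Q[ suc j ]∣ x

coeff-Q* : ∀ i p x → Q[ i ]∣ x → coeff (Q i *P p) x ≡ coeff p (divQ i x)
coeff-Q* zero    p x Q₀∣     = coeff-Q₀* p x
coeff-Q* (suc j) p x (Qₛ∣ e) = coeff-Q*-present j p x e

coeff-Q*-vanishes : ∀ i p x → (Q[ i ]∣ x → coeff p (divQ i x) ≡ 0ℚ) → coeff (Q i *P p) x ≡ 0ℚ
coeff-Q*-vanishes zero    p x h = trans (coeff-Q₀* p x) (h Q₀∣)
coeff-Q*-vanishes (suc j) p x h with expo x j in e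
... | zero  = coeff-Q*-absent j p x e
... | suc t = trans (coeff-Q*-present j p x e) (h (Qₛ∣ e))

deg-divQ : ∀ {j x} → Q[ suc j ]∣ x → suc (deg (divQ (suc j) x)) ≡ deg x
deg-divQ {j} {x} (Qₛ∣ e) = deg-decAt j x e

coeff-deriv-vanishes : ∀ k p y → coeff p (inc k y) ≡ 0ℚ → coeff (deriv k p) y ≡ 0ℚ
coeff-deriv-vanishes k p y h =
  trans (coeff-deriv k p y) (trans (cong (fromℕ (suc (expo y k)) *_) h) (ℚP.*-zeroʳ (fromℕ (suc (expo y k)))))

coeff-Q*deriv-vanishes : ∀ i k p x → (Q[ i ]∣ x → coeff p (inc k (divQ i x)) ≡ 0ℚ) →
                         coeff (Q i *P deriv k p) x ≡ 0ℚ
coeff-Q*deriv-vanishes i k p x h =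
  coeff-Q*-vanishes i (deriv k p) x (λ i∣x → coeff-deriv-vanishes k p (divQ i x) (h i∣x))

coeff-bd : ∀ p x N → bound p ≤ N → coeff (bd p) x ≡ ∑ N (λ i → coeff (Q i *P deriv i p) x)
coeff-bd p x N le =
  trans (coeff-sumBelow (bound p) (λ i → Q i *P deriv i p) x) (∑-extend (bound p) N le beyond-bound)
  where
  beyond-bound : ∀ i → bound p ≤ i → coeff (Q i *P deriv i p) x ≡ 0ℚ
  beyond-bound i le' = coeff-Q*deriv-vanishes i i p x (λ _ →
    coeff-beyond-bound p (inc i (divQ i x)) i le' (expo-inc i (divQ i x)))

coeff-Q*deriv : ∀ i k p x → Q[ i ]∣ x →
                coeff (Q i *P deriv k p) x ≡ fromℕ (suc (expo (divQ i x) k)) * coeff p (inc k (divQ i x))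
coeff-Q*deriv i k p x i∣x = trans (coeff-Q* i (deriv k p) x i∣x) (coeff-deriv k p (divQ i x))

coeff-Q*deriv² : ∀ i k ℓ p x → Q[ i ]∣ x → let y = divQ i x in
                 coeff (Q i *P deriv k (deriv ℓ p)) x
                   ≡ fromℕ (suc (expo y k)) * (fromℕ (suc (expo (inc k y) ℓ)) * coeff p (inc ℓ (inc k y)))
coeff-Q*deriv² i k ℓ p x i∣x =
  trans (coeff-Q*deriv i k (deriv ℓ p) x i∣x)
        (cong (fromℕ (suc (expo (divQ i x) k)) *_) (coeff-deriv ℓ p (inc k (divQ i x))))

coeff-Q*deriv²-vanishes : ∀ i k ℓ p x → (Q[ i ]∣ x → coeff p (inc ℓ (inc k (divQ i x))) ≡ 0ℚ) →
                          coeff (Q i *P deriv k (deriv ℓ p)) x ≡ 0ℚ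
coeff-Q*deriv²-vanishes i k ℓ p x h = coeff-Q*deriv-vanishes i k (deriv ℓ p) x (λ i∣x →
  coeff-deriv-vanishes ℓ p (inc k (divQ i x)) (h i∣x))

deg-∂-source : ∀ {j x} → Q[ suc j ]∣ x → deg (inc (suc j) (divQ (suc j) x)) ≡ deg x
deg-∂-source {j} {x} j∣x = trans (deg-inc (suc j) (divQ (suc j) x)) (deg-divQ j∣x)

lex-induction : ∀ {A : Set} (d e : A → ℕ) (P : A → Set) →
                (∀ x → (∀ z → d z < d x → P z) → (∀ z → d z ≡ d x → e z < e x → P z) → P x) →
                ∀ x → P x
lex-induction {A} d e P step x = <-rec OfDegree outer (d x) x refl
  where
  OfDegree : ℕ → Set
  OfDegree n = ∀ x → d x ≡ n → P x
  outer : ∀ n → (∀ {n'} → n' < n → OfDegree n') → OfDegree n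
  outer n lower x dx = <-rec Inner inner (e x) x dx refl
    where
    Inner : ℕ → Set
    Inner k = ∀ x → d x ≡ n → e x ≡ k → P x
    inner : ∀ k → (∀ {k'} → k' < k → Inner k') → Inner k
    inner k fewer x dx ex = step x (λ z lt → lower (subst (d z <_) dx lt) z refl)
                                   (λ z dz lt → fewer (subst (e z <_) ex lt) z (trans dz dx) refl)

module MinimalMonomial
  (f : Poly) (f∈Λ : InΛ f) (Δf-noQ₁ : ∀ x → expo x 0 ≡ 0 → coeff (Δ f) x ≡ 0ℚ)
  (m : Mono) {a : ℕ} (m-noQ₁ : expo m 0 ≡ 0) (m-Q₂ : expo m 1 ≡ suc a) (f[m]≢0 : coeff f m ≢ 0ℚ)
  (lower-deg : ∀ z → deg z < deg m → coeff f z ≡ 0ℚ)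
  (fewer-Q₂ : ∀ z → deg z ≡ deg m → expo z 1 < suc a → coeff f z ≡ 0ℚ)
  where

  x : Mono
  x = decAt 1 m

  x-noQ₁ : expo x 0 ≡ 0
  x-noQ₁ = trans (expo-decAt-≢ 1 m 0 (λ ())) m-noQ₁

  x-Q₂ : expo x 1 ≡ a
  x-Q₂ = trans (expo-decAt 1 m) (cong ℕ.pred m-Q₂)

  deg-x : suc (deg x) ≡ deg m
  deg-x = deg-decAt 1 m m-Q₂

  Q₂x≋m : inc 1 x ≋ m
  Q₂x≋m = inc-decAt 1 m m-Q₂

  B : ℕ
  B = bound f

  hasQ₁⇒0 : ∀ z {t} → expo z 0 ≡ suc t → coeff f z ≡ 0ℚ
  hasQ₁⇒0 z e = f∈Λ z (λ z-noQ₁ → ℕP.0≢1+n (trans (sym z-noQ₁) e))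

  bd-below : ∀ w → deg w < deg m → coeff (bd f) w ≡ 0ℚ
  bd-below w w<m = trans (coeff-bd f w B ℕP.≤-refl) (∑-zero B (λ i _ → term i))
    where
    term : ∀ i → coeff (Q i *P deriv i f) w ≡ 0ℚ
    term zero    = coeff-Q*deriv-vanishes 0 0 f w (λ _ → hasQ₁⇒0 (inc 0 w) (expo-inc 0 w))
    term (suc j) = coeff-Q*deriv-vanishes (suc j) (suc j) f w (λ j∣w →
      lower-deg _ (subst (_< deg m) (sym (deg-∂-source j∣w)) w<m))

  bd-at-Q₁x : coeff (bd f) (inc 0 x) ≡ fromℕ (suc a) * coeff f m
  bd-at-Q₁x = trans (coeff-bd f (inc 0 x) B ℕP.≤-refl) (trans (∑-single B 1 1<B others) Q₁∂₂f)
    where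
    1<B : 1 < B
    1<B = nonzero-coeff⇒<bound f m 1 f[m]≢0 m-Q₂
    Q₁∂₂f : coeff (Q 1 *P deriv 1 f) (inc 0 x) ≡ fromℕ (suc a) * coeff f m
    Q₁∂₂f = trans (coeff-Q*deriv 1 1 f (inc 0 x) (Qₛ∣ (expo-inc 0 x)))
      (cong₂ (λ e c → fromℕ (suc e) * c)
        (trans (expo-decAt-≢ 0 (inc 0 x) 1 (λ ())) (trans (expo-inc-≢ 0 x 1 (λ ())) x-Q₂))
        (coeff-cong f (≋-trans (inc-cong 1 (decAt-inc 0 x)) Q₂x≋m)))
    others : ∀ i → i < B → i ≢ 1 → coeff (Q i *P deriv i f) (inc 0 x) ≡ 0ℚ
    others zero          _ _  = coeff-Q*deriv-vanishes 0 0 f (inc 0 x) (λ _ →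
      hasQ₁⇒0 (inc 0 (inc 0 x)) (expo-inc 0 (inc 0 x)))
    others (suc zero)    _ ≢1 = ⊥-elim (≢1 refl)
    others (suc (suc j)) _ _  = coeff-Q*deriv-vanishes (suc (suc j)) (suc (suc j)) f (inc 0 x) (λ _ →
      hasQ₁⇒0 _ (trans (expo-inc-≢ (suc (suc j)) (decAt (suc j) (inc 0 x)) 0 (λ ()))
                  (trans (expo-decAt-≢ (suc j) (inc 0 x) 0 (λ ())) (expo-inc 0 x))))

  bd²-at-x : coeff (bd (bd f)) x ≡ fromℕ (suc a) * coeff f m
  bd²-at-x = begin
    coeff (bd (bd f)) x                               ≡⟨ coeff-bd (bd f) x N (ℕP.n≤1+n _) ⟩
    ∑ N (λ i → coeff (Q i *P deriv i (bd f)) x)       ≡⟨ ∑-single N 0 (s≤s z≤n) others ⟩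
    coeff (Q 0 *P deriv 0 (bd f)) x                   ≡⟨ coeff-Q*deriv 0 0 (bd f) x Q₀∣ ⟩
    fromℕ (suc (expo x 0)) * coeff (bd f) (inc 0 x)   ≡⟨ cong₂ (λ e c → fromℕ (suc e) * c) x-noQ₁ bd-at-Q₁x ⟩
    1ℚ * (fromℕ (suc a) * coeff f m)                  ≡⟨ ℚP.*-identityˡ _ ⟩
    fromℕ (suc a) * coeff f m                         ∎
    where
    open ≡-Reasoning
    N = suc (bound (bd f))
    others : ∀ i → i < N → i ≢ 0 → coeff (Q i *P deriv i (bd f)) x ≡ 0ℚ
    others zero    _ ≢0 = ⊥-elim (≢0 refl)
    others (suc j) _ _  = coeff-Q*deriv-vanishes (suc j) (suc j) (bd f) x (λ j∣x →
      bd-below _ (subst (_< deg m) (sym (deg-∂-source j∣x)) (subst (deg x <_) deg-x ℕP.≤-refl)))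

  Q₁-multiple⇒0 : ∀ z → coeff f (inc 0 z) ≡ 0ℚ
  Q₁-multiple⇒0 z = hasQ₁⇒0 (inc 0 z) (expo-inc 0 z)

  𝒟-term : ℕ → ℕ → ℚ
  𝒟-term k ℓ = fromℕ ((k ℕ.+ ℓ) C k) * coeff (Q (k ℕ.+ ℓ) *P deriv k (deriv ℓ f)) x

  𝒟-term-vanishes : ∀ k ℓ {i} → k ℕ.+ ℓ ≡ i →
                    (Q[ i ]∣ x → coeff f (inc ℓ (inc k (divQ i x))) ≡ 0ℚ) →
                    𝒟-term k ℓ ≡ coeff f m * fromℕ 0
  𝒟-term-vanishes k ℓ refl h =
    trans (cong (fromℕ ((k ℕ.+ ℓ) C k) *_) (coeff-Q*deriv²-vanishes (k ℕ.+ ℓ) k ℓ f x h))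
          (trans (ℚP.*-zeroʳ (fromℕ ((k ℕ.+ ℓ) C k))) (sym (ℚP.*-zeroʳ (coeff f m))))

  𝒟-term-at-m : ∀ k ℓ {i} n → k ℕ.+ ℓ ≡ i → Q[ i ]∣ x → let y = divQ i x in
                inc ℓ (inc k y) ≋ m → suc (expo y k) ℕ.* suc (expo (inc k y) ℓ) ≡ n →
                𝒟-term k ℓ ≡ coeff f m * fromℕ (((k ℕ.+ ℓ) C k) ℕ.* n)
  𝒟-term-at-m k ℓ n refl i∣x source≋m uv≡n = begin
    fromℕ b * coeff (Q (k ℕ.+ ℓ) *P deriv k (deriv ℓ f)) x
      ≡⟨ cong (fromℕ b *_) (coeff-Q*deriv² (k ℕ.+ ℓ) k ℓ f x i∣x) ⟩
    fromℕ b * (fromℕ u * (fromℕ v * coeff f (inc ℓ (inc k y))))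
      ≡⟨ cong (λ c → fromℕ b * (fromℕ u * (fromℕ v * c))) (coeff-cong f source≋m) ⟩
    fromℕ b * (fromℕ u * (fromℕ v * coeff f m))
      ≡⟨ solve 4 (λ B U V F → B :* (U :* (V :* F)) := F :* (B :* (U :* V)))
               refl (fromℕ b) (fromℕ u) (fromℕ v) (coeff f m) ⟩
    coeff f m * (fromℕ b * (fromℕ u * fromℕ v))
      ≡⟨ cong (λ c → coeff f m * (fromℕ b * c)) (sym (fromℕ-* u v)) ⟩
    coeff f m * (fromℕ b * fromℕ (u ℕ.* v))
      ≡⟨ cong (coeff f m *_) (sym (fromℕ-* b (u ℕ.* v))) ⟩
    coeff f m * fromℕ (b ℕ.* (u ℕ.* v))
      ≡⟨ cong (λ n → coeff f m * fromℕ (b ℕ.* n)) uv≡n ⟩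
    coeff f m * fromℕ (b ℕ.* n) ∎
    where
    open ≡-Reasoning
    open ℚSolver.+-*-Solver
    y = divQ (k ℕ.+ ℓ) x
    b = (k ℕ.+ ℓ) C k
    u = suc (expo y k)
    v = suc (expo (inc k y) ℓ)

  𝒟-term-Q₂-left : ∀ l → 𝒟-term 1 (suc l) ≡ coeff f m * fromℕ (((suc (suc l)) C 1) ℕ.* expo x (suc l) ℕ.* suc a)
  𝒟-term-Q₂-left l with expo x (suc l) in e
  ... | zero  = trans (𝒟-term-vanishes 1 (suc l) refl (λ { (Qₛ∣ e') → ⊥-elim (ℕP.0≢1+n (trans (sym e) e')) }))
                  (cong (λ n → coeff f m * fromℕ (n ℕ.* suc a)) (sym (ℕP.*-zeroʳ (suc (suc l) C 1))))
  ... | suc t = trans (𝒟-term-at-m 1 (suc l) (suc t ℕ.* suc a) refl (Qₛ∣ e) source≋m (product l e))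
                  (cong (λ n → coeff f m * fromℕ n) (sym (ℕP.*-assoc (suc (suc l) C 1) (suc t) (suc a))))
    where
    y = decAt (suc l) x
    source≋m : inc (suc l) (inc 1 y) ≋ m
    source≋m = ≋-trans (inc-comm (suc l) 1 y) (≋-trans (inc-cong 1 (inc-decAt (suc l) x e)) Q₂x≋m)
    product : ∀ l {t} → expo x (suc l) ≡ suc t → let y = decAt (suc l) x in
              suc (expo y 1) ℕ.* suc (expo (inc 1 y) (suc l)) ≡ suc t ℕ.* suc a
    product zero     e = cong₂ (λ u v → suc u ℕ.* v) y₁≡t
                           (trans (cong suc (trans (expo-inc 1 (decAt 1 x)) (cong suc y₁≡t)))
                                  (cong suc (trans (sym e) x-Q₂)))
      where
      y₁≡t = trans (expo-decAt 1 x) (cong ℕ.pred e)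
    product (suc l') e = trans (cong₂ (λ u v → suc u ℕ.* suc v) y₁≡a y₂≡t) (ℕP.*-comm (suc a) _)
      where
      y₁≡a = trans (expo-decAt-≢ (suc (suc l')) x 1 (λ ())) x-Q₂
      y₂≡t = trans (expo-inc-≢ 1 (decAt (suc (suc l')) x) (suc (suc l')) (λ ()))
                   (trans (expo-decAt (suc (suc l')) x) (cong ℕ.pred e))

  𝒟-term-Q₂-right : ∀ k → let K = suc (suc k) in
                    𝒟-term K 1 ≡ coeff f m * fromℕ (((K ℕ.+ 1) C K) ℕ.* expo x K ℕ.* suc a)
  𝒟-term-Q₂-right k with expo x (suc (suc k)) in e
  ... | zero  = trans (𝒟-term-vanishes (suc (suc k)) 1 (ℕP.+-comm (suc (suc k)) 1)
                         (λ { (Qₛ∣ e') → ⊥-elim (ℕP.0≢1+n (trans (sym e) e')) }))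
                  (cong (λ n → coeff f m * fromℕ (n ℕ.* suc a))
                        (sym (ℕP.*-zeroʳ ((suc (suc k) ℕ.+ 1) C suc (suc k)))))
  ... | suc t = trans (𝒟-term-at-m K 1 (suc t ℕ.* suc a) (ℕP.+-comm K 1) (Qₛ∣ e) source≋m product)
                  (cong (λ n → coeff f m * fromℕ n) (sym (ℕP.*-assoc ((K ℕ.+ 1) C K) (suc t) (suc a))))
    where
    K = suc (suc k)
    y = decAt K x
    source≋m : inc 1 (inc K y) ≋ m
    source≋m = ≋-trans (inc-cong 1 (inc-decAt K x e)) Q₂x≋m
    product : suc (expo y K) ℕ.* suc (expo (inc K y) 1) ≡ suc t ℕ.* suc a
    product = cong₂ (λ u v → suc u ℕ.* suc v) (trans (expo-decAt K x) (cong ℕ.pred e))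
                (trans (expo-inc-≢ K y 1 (λ ())) (trans (expo-decAt-≢ K x 1 (λ ())) x-Q₂))

  weight : ℕ → ℕ → ℕ
  weight (suc zero)    (suc l)    = ((suc (suc l)) C 1) ℕ.* expo x (suc l)
  weight (suc (suc k)) (suc zero) = ((suc (suc k) ℕ.+ 1) C suc (suc k)) ℕ.* expo x (suc (suc k))
  weight _             _          = 0

  𝒟-term≡ : ∀ k ℓ → 𝒟-term k ℓ ≡ coeff f m * fromℕ (weight k ℓ ℕ.* suc a)
  𝒟-term≡ zero          ℓ             = 𝒟-term-vanishes 0 ℓ refl (λ _ →
    trans (coeff-cong f (inc-comm ℓ 0 (divQ ℓ x))) (Q₁-multiple⇒0 (inc ℓ (divQ ℓ x))))
  𝒟-term≡ (suc zero)    zero          = 𝒟-term-vanishes 1 0 refl (λ _ → Q₁-multiple⇒0 _)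
  𝒟-term≡ (suc (suc k)) zero          = 𝒟-term-vanishes (suc (suc k)) 0 refl (λ _ → Q₁-multiple⇒0 _)
  𝒟-term≡ (suc zero)    (suc l)       = 𝒟-term-Q₂-left l
  𝒟-term≡ (suc (suc k)) (suc zero)    = 𝒟-term-Q₂-right k
  𝒟-term≡ (suc (suc k)) (suc (suc l)) = 𝒟-term-vanishes K L refl (λ { (Qₛ∣ e) → fewer-Q₂ _ (same-deg e) fewer })
    where
    K = suc (suc k)
    L = suc (suc l)
    j = suc (k ℕ.+ L)
    y = decAt j x
    1≢j : 1 ≢ j
    1≢j q = ℕP.0≢1+n (trans (ℕP.suc-injective q) (ℕP.+-suc k (suc l)))
    same-deg : ∀ {t} → expo x j ≡ suc t → deg (inc L (inc K y)) ≡ deg m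
    same-deg e = trans (deg-inc L (inc K y))
                   (trans (cong suc (trans (deg-inc K y) (deg-decAt j x e))) deg-x)
    fewer : expo (inc L (inc K y)) 1 < suc a
    fewer = ℕP.≤-reflexive (cong suc
      (trans (expo-inc-≢ L (inc K y) 1 (λ ())) (trans (expo-inc-≢ K y 1 (λ ()))
             (trans (expo-decAt-≢ j x 1 1≢j) x-Q₂))))

  total-weight : ℕ
  total-weight = ∑ℕ B (λ k → ∑ℕ B (weight k))

  𝒟-at-x : coeff (𝒟 f) x ≡ coeff f m * fromℕ (total-weight ℕ.* suc a)
  𝒟-at-x = begin
    coeff (𝒟 f) x                                                   ≡⟨ coeff-sumBelow B (λ k → sumBelow B (summand k)) x ⟩
    ∑ B (λ k → coeff (sumBelow B (summand k)) x)                    ≡⟨ ∑-cong B (λ k _ → row k) ⟩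
    ∑ B (λ k → coeff f m * fromℕ (∑ℕ B (λ ℓ → weight k ℓ ℕ.* suc a))) ≡⟨ ∑-*fromℕ B (coeff f m) _ ⟩
    coeff f m * fromℕ (∑ℕ B (λ k → ∑ℕ B (λ ℓ → weight k ℓ ℕ.* suc a))) ≡⟨ cong (λ n → coeff f m * fromℕ n) factor ⟩
    coeff f m * fromℕ (total-weight ℕ.* suc a)                       ∎
    where
    open ≡-Reasoning
    summand : ℕ → ℕ → Poly
    summand k ℓ = scale (fromℕ ((k ℕ.+ ℓ) C k)) (Q (k ℕ.+ ℓ) *P deriv k (deriv ℓ f))
    row : ∀ k → coeff (sumBelow B (summand k)) x ≡ coeff f m * fromℕ (∑ℕ B (λ ℓ → weight k ℓ ℕ.* suc a))
    row k = trans (coeff-sumBelow B (summand k) x)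
      (trans (∑-cong B (λ ℓ _ → trans (coeff-scale _ (Q (k ℕ.+ ℓ) *P deriv k (deriv ℓ f)) x) (𝒟-term≡ k ℓ)))
             (∑-*fromℕ B (coeff f m) _))
    factor : ∑ℕ B (λ k → ∑ℕ B (λ ℓ → weight k ℓ ℕ.* suc a)) ≡ total-weight ℕ.* suc a
    factor = trans (∑ℕ-cong B (λ k → ∑ℕ-*ʳ B (weight k) (suc a))) (∑ℕ-*ʳ B (λ k → ∑ℕ B (weight k)) (suc a))

  weight-ZeroOr≥2 : ∀ k ℓ → ZeroOr≥2 (weight k ℓ)
  weight-ZeroOr≥2 zero          ℓ             = inj₁ refl
  weight-ZeroOr≥2 (suc zero)    zero          = inj₁ refl
  weight-ZeroOr≥2 (suc zero)    (suc l)       =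
    ZeroOr≥2-* (ℕP.≤-trans (s≤s (s≤s z≤n)) (ℕP.≤-reflexive (sym (nC1≡n (suc (suc l)))))) (expo x (suc l))
  weight-ZeroOr≥2 (suc (suc k)) zero          = inj₁ refl
  weight-ZeroOr≥2 (suc (suc k)) (suc zero)    =
    ZeroOr≥2-* (ℕP.≤-trans (ℕP.m≤m+n 2 (k ℕ.+ 1)) (ℕP.≤-reflexive (sym binom))) (expo x (suc (suc k)))
    where
    binom : (suc (suc k) ℕ.+ 1) C suc (suc k) ≡ suc (suc k) ℕ.+ 1
    binom = trans (nCk≡nC[n∸k] (ℕP.m≤m+n (suc (suc k)) 1))
                  (trans (cong ((suc (suc k) ℕ.+ 1) C_) (ℕP.m+n∸m≡n (suc (suc k)) 1)) (nC1≡n (suc (suc k) ℕ.+ 1)))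
  weight-ZeroOr≥2 (suc (suc k)) (suc (suc l)) = inj₁ refl

  impossible : ⊥
  impossible = ZeroOr≥2⇒≢1 total-weight-ZeroOr≥2 total-weight≡1
    where
    total-weight-ZeroOr≥2 : ZeroOr≥2 total-weight
    total-weight-ZeroOr≥2 = ZeroOr≥2-∑ℕ B _ (λ k → ZeroOr≥2-∑ℕ B (weight k) (weight-ZeroOr≥2 k))
    𝒟≡∂² : coeff (𝒟 f) x ≡ coeff (bd (bd f)) x
    𝒟≡∂² = ½[p-q]≡0⇒p≡q _ _ (trans (sym (coeff-Δ f x)) (Δf-noQ₁ x x-noQ₁))
    balance : coeff f m * fromℕ (total-weight ℕ.* suc a) ≡ coeff f m * fromℕ (1 ℕ.* suc a)
    balance = begin
      coeff f m * fromℕ (total-weight ℕ.* suc a) ≡⟨ sym 𝒟-at-x ⟩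
      coeff (𝒟 f) x                              ≡⟨ 𝒟≡∂² ⟩
      coeff (bd (bd f)) x                        ≡⟨ bd²-at-x ⟩
      fromℕ (suc a) * coeff f m                  ≡⟨ ℚP.*-comm (fromℕ (suc a)) (coeff f m) ⟩
      coeff f m * fromℕ (suc a)                  ≡⟨ cong (λ n → coeff f m * fromℕ n) (sym (ℕP.*-identityˡ (suc a))) ⟩
      coeff f m * fromℕ (1 ℕ.* suc a)            ∎
      where open ≡-Reasoning
    total-weight≡1 : total-weight ≡ 1
    total-weight≡1 =
      ℕP.*-cancelʳ-≡ total-weight 1 (suc a) (fromℕ-injective (*-cancelˡ-≡ (coeff f m) f[m]≢0 balance))

proposition4p2 : (f : Poly) → InQ₂Λ f → ¬ IsZero f → ¬ Inℋ f
proposition4p2 f (g , _ , f≈Q₂g) f≢0 (f∈Λ , h , Δf≈Q₁h) =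
  f≢0 (lex-induction deg (λ z → expo z 1) (λ z → coeff f z ≡ 0ℚ) minimal-vanishes)
  where
  noQ₂⇒0 : ∀ z → expo z 1 ≡ 0 → coeff f z ≡ 0ℚ
  noQ₂⇒0 z e = trans (f≈Q₂g z) (coeff-Q*-absent 1 g z e)

  Δf-noQ₁ : ∀ z → expo z 0 ≡ 0 → coeff (Δ f) z ≡ 0ℚ
  Δf-noQ₁ z e = trans (Δf≈Q₁h z) (coeff-Q*-absent 0 h z e)

  minimal-vanishes : ∀ m → (∀ z → deg z < deg m → coeff f z ≡ 0ℚ) →
                     (∀ z → deg z ≡ deg m → expo z 1 < expo m 1 → coeff f z ≡ 0ℚ) → coeff f m ≡ 0ℚ
  minimal-vanishes m lower-deg fewer-Q₂ with expo m 0 in e₀ | expo m 1 in e₁ | coeff f m ℚP.≟ 0ℚ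
  ... | suc _ | _     | _          = f∈Λ m (λ e₀≡0 → ℕP.0≢1+n (trans (sym e₀≡0) e₀))
  ... | zero  | zero  | _          = noQ₂⇒0 m e₁
  ... | zero  | suc _ | yes f[m]≡0 = f[m]≡0
  ... | zero  | suc _ | no f[m]≢0  =
    ⊥-elim (MinimalMonomial.impossible f f∈Λ Δf-noQ₁ m e₀ e₁ f[m]≢0 lower-deg fewer-Q₂)
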